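{- Let $G,H\in\mathcal D$. Then $G\geq_{\mathcal D}H$ if and only if all of the following hold: (1) $o(G)\geq o(H)$; (2) for every Left option $H^L$ of $H$, either there is a Left option $G^L$ of $G$ with $G^L\geq_{\mathcal D}H^L$, or there is a Right option $H^{LR}$ of $H^L$ with $G\geq_{\mathcal D}H^{LR}$; (3) for every Right option $G^R$ of $G$, either there is a Right option $H^R$ of $H$ with $G^R\geq_{\mathcal D}H^R$, or there is a Left option $G^{RL}$ of $G^R$ with $G^{RL}\geq_{\mathcal D}H$.
   Context: All games are short two-player partizan games between Left and Right, identified with their game trees: $G=\{G^{\mathcal L}\mid G^{\mathcal R}\}$ with finite sets of Left and Right options. Followers of $G$: $G$, its options, their options, etc. Disjunctive sum: $G+H=\{G^{\mathcal L}+H,G+H^{\mathcal L}\mid G^{\mathcal R}+H,G+H^{\mathcal R}\}$. Misère play: a player with no move on their turn wins. $o_L(G)=\mathrm L$ if $G^{\mathcal L}=\emptyset$, else $\max_{G^L}o_R(G^L)$; $o_R(G)=\mathrm R$ if $G^{\mathcal R}=\emptyset$, else $\min_{G^R}o_L(G^R)$; $\mathrm L>\mathrm R$. The outcome $o(G)$ is $\mathscr L,\mathscr N,\mathscr P,\mathscr R$ according as $(o_L(G),o_R(G))=(\mathrm L,\mathrm L),(\mathrm L,\mathrm R),(\mathrm R,\mathrm L),(\mathrm R,\mathrm R)$, partially ordered by $\mathscr L>\mathscr N>\mathscr R$, $\mathscr L>\mathscr P>\mathscr R$, $\mathscr N,\mathscr P$ incomparable. A game is a dicot if for each of its followers either both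 players have a move or neither does; $\mathcal D$ is the class of dicots. $G\geq_{\mathcal D}H$ means $o(G+X)\geq o(H+X)$ for all $X\in\mathcal D$. -}

module Defs where

open import Data.List using (List; []; _∷_; _++_)
open import Data.List.Relation.Unary.All using (All)
open import Data.List.Relation.Unary.Any using (Any)
open import Data.List.Membership.Propositional using (_∈_)
open import Data.Product using (_×_; Σ; ∃-syntax; _,_)
open import Data.Sum using (_⊎_)

data Game : Set where
  ⟨_∣_⟩ : List Game → List Game → Game

leftOpts : Game → List Game
leftOpts ⟨ ls ∣ rs ⟩ = ls

rightOpts : Game → List Game
rightOpts ⟨ ls ∣ rs ⟩ = rs

mutual
  _⊕_ : Game → Game → Game
  ⟨ gl ∣ gr ⟩ ⊕ ⟨ hl ∣ hr ⟩ =
    ⟨ mapL gl ⟨ hl ∣ hr ⟩ ++ mapR ⟨ gl ∣ gr ⟩ hl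
    ∣ mapL gr ⟨ hl ∣ hr ⟩ ++ mapR ⟨ gl ∣ gr ⟩ hr ⟩

  mapL : List Game → Game → List Game
  mapL [] h = []
  mapL (x ∷ xs) h = (x ⊕ h) ∷ mapL xs h

  mapR : Game → List Game → List Game
  mapR g [] = []
  mapR g (y ∷ ys) = (g ⊕ y) ∷ mapR g ys

infixl 6 _⊕_

data Result : Set where
  L R : Result

data _≥ʳ_ : Result → Result → Set where
  L≥ : ∀ {x} → L ≥ʳ x
  R≥R : R ≥ʳ R

-- Misère outcome: a player with no move on their turn wins.
mutual
  oL : Game → Result
  oL ⟨ [] ∣ rs ⟩ = L
  oL ⟨ l ∷ ls ∣ rs ⟩ = maxOR (l ∷ ls)

  oR : Game → Result
  oR ⟨ ls ∣ [] ⟩ = R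
  oR ⟨ ls ∣ r ∷ rs ⟩ = minOL (r ∷ rs)

  maxOR : List Game → Result
  maxOR [] = R
  maxOR (g ∷ gs) with oR g
  ... | L = L
  ... | R = maxOR gs

  minOL : List Game → Result
  minOL [] = L
  minOL (g ∷ gs) with oL g
  ... | R = R
  ... | L = minOL gs

data Outcome : Set where
  𝓛 𝓝 𝓟 𝓡 : Outcome

toOutcome : Result → Result → Outcome
toOutcome L L = 𝓛
toOutcome L R = 𝓝
toOutcome R L = 𝓟
toOutcome R R = 𝓡

o : Game → Outcome
o G = toOutcome (oL G) (oR G)

data _≥ᵒ_ : Outcome → Outcome → Set where
  refl≥ : ∀ {x} → x ≥ᵒ x
  𝓛≥ : ∀ {x} → 𝓛 ≥ᵒ x
  ≥𝓡 : ∀ {x} → x ≥ᵒ 𝓡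

data IsDicot : Game → Set where
  dicot-empty : IsDicot ⟨ [] ∣ [] ⟩
  dicot-cons : ∀ {l ls r rs} →
    All IsDicot (l ∷ ls) → All IsDicot (r ∷ rs) →
    IsDicot ⟨ l ∷ ls ∣ r ∷ rs ⟩

_≥D_ : Game → Game → Set
G ≥D H = ∀ X → IsDicot X → o (G ⊕ X) ≥ᵒ o (H ⊕ X)

module Submission where

open import Defs
open import Data.List.Relation.Unary.All using (All)
open import Data.List.Relation.Unary.Any using (Any)
open import Data.Product using (_×_)
open import Data.Sum using (_⊎_)
open import Function.Bundles using (_⇔_)

open import Data.List using (List; []; _∷_; [_])
open import Data.List.Properties using (++-identityʳ)
open import Data.List.Relation.Unary.All as All using ([]; _∷_)
open import Data.List.Relation.Unary.All.Properties using (++⁺)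
open import Data.List.Relation.Unary.Any using (here; there)
open import Data.List.Relation.Unary.Any.Properties using (++⁺ˡ; ++⁺ʳ; ++⁻; mapWith∈⁺; mapWith∈⁻)
open import Data.List.Membership.Propositional using (_∈_; mapWith∈; find; lose)
open import Data.Product as Product using (Σ; _,_; proj₁; proj₂)
open import Data.Sum as Sum using (inj₁; inj₂)
open import Data.Empty using (⊥-elim)
open import Relation.Nullary using (¬_)
open import Data.Nat using (ℕ; suc; _+_; _≤_; _<_; s≤s)
open import Data.Nat.Properties using (≤-trans; m≤m+n; m≤n+m; <-trans; +-mono-<; +-monoʳ-<; +-monoˡ-<)
open import Data.Nat.Induction using (<-wellFounded)
open import Induction.WellFounded using (Acc; acc)
open import Relation.Binary.PropositionalEquality using (_≡_; _≢_; refl; sym; trans; cong₂; subst)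
open import Function.Bundles using (mk⇔)

-- Assuming the three conditions, o(G+X) ≥ o(H+X) is proved for
-- every dicot X by induction on X, separately for Left moving first and Right
-- moving first: a winning first move in H+X (resp. a Right move in G+X) is
-- matched using condition (2) (resp. (3)) or the induction hypothesis.
--
-- Necessity is proved constructively.  A refutation of G ≥ H is a dicot test X
-- on which one of the two results of G+X is strictly worse for Left than that of
-- H+X.  By well-founded induction on size G + size H, every pair of dicots either
-- satisfies the three conditions or has a refutation: a failure of (1) is refuted
-- by 0, and a failure of (2) at H^L (resp. of (3) at G^R) provides refutations of
-- the smaller pairs involved, from which a test T downlinking G to H^L (resp. G^R
-- to H) is assembled out of adjoints; T refutes G ≥ H.  Since a refutation is
-- incompatible with G ≥ H, the theorem follows.

any-or-all : ∀ {A : Set} {P Q : A → Set} {xs : List A} →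
  (∀ {x} → x ∈ xs → P x ⊎ Q x) → Any P xs ⊎ All Q xs
any-or-all {xs = []} decide = inj₂ []
any-or-all {xs = x ∷ xs} decide with decide (here refl) | any-or-all (λ m → decide (there m))
... | inj₁ p | _ = inj₁ (here p)
... | inj₂ _ | inj₁ ps = inj₁ (there ps)
... | inj₂ q | inj₂ qs = inj₂ (q ∷ qs)

all-or-any : ∀ {A : Set} {P Q : A → Set} {xs : List A} →
  (∀ {x} → x ∈ xs → P x ⊎ Q x) → All P xs ⊎ Any Q xs
all-or-any decide = Sum.swap (any-or-all (λ m → Sum.swap (decide m)))

-- The shape of conditions (2) and (3): a witness in one of two lists, or
-- a counter-witness for every element of both.
some-or-none : ∀ {A B : Set} {P P′ : A → Set} {Q Q′ : B → Set} {xs : List A} {ys : List B} →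
  (∀ {x} → x ∈ xs → P x ⊎ P′ x) → (∀ {y} → y ∈ ys → Q y ⊎ Q′ y) →
  (Any P xs ⊎ Any Q ys) ⊎ (All P′ xs × All Q′ ys)
some-or-none decideP decideQ with any-or-all decideP | any-or-all decideQ
... | inj₁ p | _ = inj₁ (inj₁ p)
... | inj₂ _ | inj₁ q = inj₁ (inj₂ q)
... | inj₂ p′ | inj₂ q′ = inj₂ (p′ , q′)

∈-mapWith∈ : ∀ {A B : Set} {xs : List A} (f : ∀ {x} → x ∈ xs → B) {x} (m : x ∈ xs) →
  f m ∈ mapWith∈ xs f
∈-mapWith∈ f m = mapWith∈⁺ f (_ , m , refl)

All-mapWith∈ : ∀ {A B : Set} {P : B → Set} {xs : List A} (f : ∀ {x} → x ∈ xs → B) →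
  (∀ {x} (m : x ∈ xs) → P (f m)) → All P (mapWith∈ xs f)
All-mapWith∈ {P = P} {xs} f p = All.tabulate λ y∈ →
  let _ , m , y≡fm = mapWith∈⁻ xs f y∈ in subst P (sym y≡fm) (p m)

R≢L : R ≢ L
R≢L ()

≥ʳ-elim : ∀ {a c} → a ≥ʳ c → c ≡ L → a ≡ L
≥ʳ-elim L≥ _ = refl
≥ʳ-elim R≥R ()

≥ʳ-intro : ∀ a c → (c ≡ L → a ≡ L) → a ≥ʳ c
≥ʳ-intro L c _ = L≥
≥ʳ-intro R R _ = R≥R
≥ʳ-intro R L imp = ⊥-elim (R≢L (imp refl))

≥ʳ-or-gap : ∀ a c → a ≥ʳ c ⊎ (c ≡ L × a ≡ R)
≥ʳ-or-gap L c = inj₁ L≥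
≥ʳ-or-gap R R = inj₁ R≥R
≥ʳ-or-gap R L = inj₂ (refl , refl)

≥ᵒ-components : ∀ {a b c d} → toOutcome a b ≥ᵒ toOutcome c d → a ≥ʳ c × b ≥ʳ d
≥ᵒ-components {L} {L} _ = L≥ , L≥
≥ᵒ-components {L} {R} {c} {R} _ = L≥ , R≥R
≥ᵒ-components {R} {L} {R} _ = R≥R , L≥
≥ᵒ-components {R} {R} {R} {R} _ = R≥R , R≥R
≥ᵒ-components {L} {R} {L} {L} ()
≥ᵒ-components {L} {R} {R} {L} ()
≥ᵒ-components {R} {L} {L} {L} ()
≥ᵒ-components {R} {L} {L} {R} ()
≥ᵒ-components {R} {R} {L} {L} ()
≥ᵒ-components {R} {R} {L} {R} ()
≥ᵒ-components {R} {R} {R} {L} ()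

≥ᵒ-from-components : ∀ {a b c d} → a ≥ʳ c → b ≥ʳ d → toOutcome a b ≥ᵒ toOutcome c d
≥ᵒ-from-components L≥ L≥ = 𝓛≥
≥ᵒ-from-components {c = L} L≥ R≥R = refl≥
≥ᵒ-from-components {c = R} L≥ R≥R = ≥𝓡
≥ᵒ-from-components {d = L} R≥R L≥ = refl≥
≥ᵒ-from-components {d = R} R≥R L≥ = ≥𝓡
≥ᵒ-from-components R≥R R≥R = refl≥

maxOR-L : ∀ {ks} → Any (λ k → oR k ≡ L) ks → maxOR ks ≡ L
maxOR-L {g ∷ _} (here oRg≡L) rewrite oRg≡L = refl
maxOR-L {g ∷ _} (there p) with oR g
... | L = refl
... | R = maxOR-L p

maxOR-R : ∀ {ks} → All (λ k → oR k ≡ R) ks → maxOR ks ≡ R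
maxOR-R [] = refl
maxOR-R (oRg≡R ∷ ps) rewrite oRg≡R = maxOR-R ps

maxOR-L⁻ : ∀ {ks} → maxOR ks ≡ L → Any (λ k → oR k ≡ L) ks
maxOR-L⁻ {g ∷ _} max≡L with oR g in oRg
... | L = here oRg
... | R = there (maxOR-L⁻ max≡L)

minOL-R : ∀ {ks} → Any (λ k → oL k ≡ R) ks → minOL ks ≡ R
minOL-R {g ∷ _} (here oLg≡R) rewrite oLg≡R = refl
minOL-R {g ∷ _} (there p) with oL g
... | R = refl
... | L = minOL-R p

minOL-L : ∀ {ks} → All (λ k → oL k ≡ L) ks → minOL ks ≡ L
minOL-L [] = refl
minOL-L (oLg≡L ∷ ps) rewrite oLg≡L = minOL-L ps

minOL-L⁻ : ∀ {ks} → minOL ks ≡ L → All (λ k → oL k ≡ L) ks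
minOL-L⁻ {[]} _ = []
minOL-L⁻ {g ∷ _} min≡L with oL g in oLg
... | L = oLg ∷ minOL-L⁻ min≡L
... | R = ⊥-elim (R≢L min≡L)

-- The same facts for games.  The membership arguments only record that the
-- relevant player has a move, since a player without moves wins.
oL-L-intro : ∀ K {k} → k ∈ leftOpts K → oR k ≡ L → oL K ≡ L
oL-L-intro ⟨ _ ∷ _ ∣ _ ⟩ m oRk≡L = maxOR-L (lose m oRk≡L)

oL-R-intro : ∀ K {k} → k ∈ leftOpts K → All (λ k → oR k ≡ R) (leftOpts K) → oL K ≡ R
oL-R-intro ⟨ _ ∷ _ ∣ _ ⟩ _ ps = maxOR-R ps

oL-L-elim : ∀ K {k} → k ∈ leftOpts K → oL K ≡ L → Any (λ k → oR k ≡ L) (leftOpts K)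
oL-L-elim ⟨ _ ∷ _ ∣ _ ⟩ _ oLK≡L = maxOR-L⁻ oLK≡L

oR-R-intro : ∀ K {k} → k ∈ rightOpts K → oL k ≡ R → oR K ≡ R
oR-R-intro ⟨ _ ∣ _ ∷ _ ⟩ m oLk≡R = minOL-R (lose m oLk≡R)

oR-L-intro : ∀ K {k} → k ∈ rightOpts K → All (λ k → oL k ≡ L) (rightOpts K) → oR K ≡ L
oR-L-intro ⟨ _ ∣ _ ∷ _ ⟩ _ ps = minOL-L ps

oR-L-elim : ∀ K → oR K ≡ L → All (λ k → oL k ≡ L) (rightOpts K)
oR-L-elim ⟨ _ ∣ [] ⟩ ()
oR-L-elim ⟨ _ ∣ _ ∷ _ ⟩ oRK≡L = minOL-L⁻ oRK≡L

mapL-∈ : ∀ {g gs} h → g ∈ gs → (g ⊕ h) ∈ mapL gs h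
mapL-∈ h (here refl) = here refl
mapL-∈ h (there m) = there (mapL-∈ h m)

mapR-∈ : ∀ {x xs} g → x ∈ xs → (g ⊕ x) ∈ mapR g xs
mapR-∈ g (here refl) = here refl
mapR-∈ g (there m) = there (mapR-∈ g m)

mapL-All : ∀ {P : Game → Set} {gs} h → All (λ g → P (g ⊕ h)) gs → All P (mapL gs h)
mapL-All h [] = []
mapL-All h (p ∷ ps) = p ∷ mapL-All h ps

mapR-All : ∀ {P : Game → Set} {xs} g → All (λ x → P (g ⊕ x)) xs → All P (mapR g xs)
mapR-All g [] = []
mapR-All g (p ∷ ps) = p ∷ mapR-All g ps

mapL-Any⁻ : ∀ {P : Game → Set} gs h → Any P (mapL gs h) → Any (λ g → P (g ⊕ h)) gs
mapL-Any⁻ (_ ∷ _) h (here p) = here p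
mapL-Any⁻ (_ ∷ gs) h (there p) = there (mapL-Any⁻ gs h p)

mapR-Any⁻ : ∀ {P : Game → Set} g xs → Any P (mapR g xs) → Any (λ x → P (g ⊕ x)) xs
mapR-Any⁻ g (_ ∷ _) (here p) = here p
mapR-Any⁻ g (_ ∷ xs) (there p) = there (mapR-Any⁻ g xs p)

leftMoveˡ : ∀ G X {g} → g ∈ leftOpts G → (g ⊕ X) ∈ leftOpts (G ⊕ X)
leftMoveˡ ⟨ _ ∣ _ ⟩ ⟨ xl ∣ xr ⟩ m = ++⁺ˡ (mapL-∈ ⟨ xl ∣ xr ⟩ m)

leftMoveʳ : ∀ G X {x} → x ∈ leftOpts X → (G ⊕ x) ∈ leftOpts (G ⊕ X)
leftMoveʳ ⟨ gl ∣ gr ⟩ ⟨ xl ∣ xr ⟩ m = ++⁺ʳ (mapL gl ⟨ xl ∣ xr ⟩) (mapR-∈ ⟨ gl ∣ gr ⟩ m)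

rightMoveˡ : ∀ G X {g} → g ∈ rightOpts G → (g ⊕ X) ∈ rightOpts (G ⊕ X)
rightMoveˡ ⟨ _ ∣ _ ⟩ ⟨ xl ∣ xr ⟩ m = ++⁺ˡ (mapL-∈ ⟨ xl ∣ xr ⟩ m)

rightMoveʳ : ∀ G X {x} → x ∈ rightOpts X → (G ⊕ x) ∈ rightOpts (G ⊕ X)
rightMoveʳ ⟨ gl ∣ gr ⟩ ⟨ xl ∣ xr ⟩ m = ++⁺ʳ (mapL gr ⟨ xl ∣ xr ⟩) (mapR-∈ ⟨ gl ∣ gr ⟩ m)

allLeftMoves : ∀ {P : Game → Set} G X →
  All (λ g → P (g ⊕ X)) (leftOpts G) → All (λ x → P (G ⊕ x)) (leftOpts X) →
  All P (leftOpts (G ⊕ X))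
allLeftMoves ⟨ _ ∣ _ ⟩ ⟨ xl ∣ xr ⟩ pG pX = ++⁺ (mapL-All ⟨ xl ∣ xr ⟩ pG) (mapR-All _ pX)

allRightMoves : ∀ {P : Game → Set} G X →
  All (λ g → P (g ⊕ X)) (rightOpts G) → All (λ x → P (G ⊕ x)) (rightOpts X) →
  All P (rightOpts (G ⊕ X))
allRightMoves ⟨ _ ∣ _ ⟩ ⟨ xl ∣ xr ⟩ pG pX = ++⁺ (mapL-All ⟨ xl ∣ xr ⟩ pG) (mapR-All _ pX)

anyLeftMove⁻ : ∀ {P : Game → Set} G X → Any P (leftOpts (G ⊕ X)) →
  Any (λ g → P (g ⊕ X)) (leftOpts G) ⊎ Any (λ x → P (G ⊕ x)) (leftOpts X)
anyLeftMove⁻ ⟨ gl ∣ gr ⟩ ⟨ xl ∣ xr ⟩ p =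
  Sum.map (mapL-Any⁻ gl ⟨ xl ∣ xr ⟩) (mapR-Any⁻ ⟨ gl ∣ gr ⟩ xl) (++⁻ (mapL gl ⟨ xl ∣ xr ⟩) p)

zeroG : Game
zeroG = ⟨ [] ∣ [] ⟩

mutual
  ⊕-zero : ∀ G → G ⊕ zeroG ≡ G
  ⊕-zero ⟨ gl ∣ gr ⟩ =
    cong₂ ⟨_∣_⟩ (trans (++-identityʳ _) (mapL-zero gl)) (trans (++-identityʳ _) (mapL-zero gr))

  mapL-zero : ∀ gs → mapL gs zeroG ≡ gs
  mapL-zero [] = refl
  mapL-zero (g ∷ gs) = cong₂ _∷_ (⊕-zero g) (mapL-zero gs)

dicotL : ∀ {G} → IsDicot G → All IsDicot (leftOpts G)
dicotL dicot-empty = []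
dicotL (dicot-cons dls _) = dls

dicotR : ∀ {G} → IsDicot G → All IsDicot (rightOpts G)
dicotR dicot-empty = []
dicotR (dicot-cons _ drs) = drs

leftMove-or-zero : ∀ {G X} → IsDicot G → IsDicot X →
  (G ≡ zeroG × X ≡ zeroG) ⊎ Σ Game (_∈ leftOpts (G ⊕ X))
leftMove-or-zero dicot-empty dicot-empty = inj₁ (refl , refl)
leftMove-or-zero {G} {X} (dicot-cons _ _) _ = inj₂ (_ , leftMoveˡ G X (here refl))
leftMove-or-zero {G} {X} dicot-empty (dicot-cons _ _) = inj₂ (_ , leftMoveʳ G X (here refl))

rightMove-or-zero : ∀ {G X} → IsDicot G → IsDicot X →
  (G ≡ zeroG × X ≡ zeroG) ⊎ Σ Game (_∈ rightOpts (G ⊕ X))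
rightMove-or-zero dicot-empty dicot-empty = inj₁ (refl , refl)
rightMove-or-zero {G} {X} (dicot-cons _ _) _ = inj₂ (_ , rightMoveˡ G X (here refl))
rightMove-or-zero {G} {X} dicot-empty (dicot-cons _ _) = inj₂ (_ , rightMoveʳ G X (here refl))

mutual
  size : Game → ℕ
  size ⟨ ls ∣ rs ⟩ = suc (sizes ls + sizes rs)

  sizes : List Game → ℕ
  sizes [] = 0
  sizes (g ∷ gs) = size g + sizes gs

∈-size : ∀ {g gs} → g ∈ gs → size g ≤ sizes gs
∈-size {g} {_ ∷ gs} (here refl) = m≤m+n (size g) (sizes gs)
∈-size {g} {h ∷ gs} (there m) = ≤-trans (∈-size m) (m≤n+m (sizes gs) (size h))

sizeL : ∀ G {g} → g ∈ leftOpts G → size g < size G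
sizeL ⟨ ls ∣ rs ⟩ m = s≤s (≤-trans (∈-size m) (m≤m+n (sizes ls) (sizes rs)))

sizeR : ∀ G {g} → g ∈ rightOpts G → size g < size G
sizeR ⟨ ls ∣ rs ⟩ m = s≤s (≤-trans (∈-size m) (m≤n+m (sizes rs) (sizes ls)))

star : Game
star = ⟨ [ zeroG ] ∣ [ zeroG ] ⟩

mutual
  adj : Game → Game
  adj ⟨ [] ∣ [] ⟩ = star
  adj ⟨ ls ∣ rs ⟩ = ⟨ adjs rs ∣ adjs ls ⟩

  adjs : List Game → List Game
  adjs [] = []
  adjs (g ∷ gs) = adj g ∷ adjs gs

adjs-∈ : ∀ {g gs} → g ∈ gs → adj g ∈ adjs gs
adjs-∈ (here refl) = here refl
adjs-∈ (there m) = there (adjs-∈ m)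

adjs-All : ∀ {P : Game → Set} {gs} → All (λ g → P (adj g)) gs → All P (adjs gs)
adjs-All [] = []
adjs-All (p ∷ ps) = p ∷ adjs-All ps

mutual
  adj-dicot : ∀ {G} → IsDicot G → IsDicot (adj G)
  adj-dicot dicot-empty = dicot-cons (dicot-empty ∷ []) (dicot-empty ∷ [])
  adj-dicot (dicot-cons dls drs) = dicot-cons (adjs-dicot drs) (adjs-dicot dls)

  adjs-dicot : ∀ {gs} → All IsDicot gs → All IsDicot (adjs gs)
  adjs-dicot [] = []
  adjs-dicot (d ∷ ds) = adj-dicot d ∷ adjs-dicot ds

AdjointP : Game → Set
AdjointP G = oL (G ⊕ adj G) ≡ R × oR (G ⊕ adj G) ≡ L

-- Every move in G + G° is answered by the mirror move, leading to some
-- G' + G'° with G' an option of G, which is a P-position by induction.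
adjointP-step : ∀ {l ls r rs} → All AdjointP (l ∷ ls) → All AdjointP (r ∷ rs) →
  AdjointP ⟨ l ∷ ls ∣ r ∷ rs ⟩
adjointP-step {l} {ls} {r} {rs} pl pr =
  oL-R-intro (G ⊕ A) (leftMoveˡ G A (here refl))
    (allLeftMoves G A (All.tabulate mirrorLeftInG) (adjs-All (All.tabulate mirrorLeftInA))) ,
  oR-L-intro (G ⊕ A) (rightMoveˡ G A (here refl))
    (allRightMoves G A (All.tabulate mirrorRightInG) (adjs-All (All.tabulate mirrorRightInA)))
  where
    G A : Game
    G = ⟨ l ∷ ls ∣ r ∷ rs ⟩
    A = adj G
    mirrorLeftInG : ∀ {g} → g ∈ l ∷ ls → oR (g ⊕ A) ≡ R
    mirrorLeftInG {g} m = oR-R-intro (g ⊕ A) (rightMoveʳ g A (adjs-∈ m)) (proj₁ (All.lookup pl m))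
    mirrorLeftInA : ∀ {g} → g ∈ r ∷ rs → oR (G ⊕ adj g) ≡ R
    mirrorLeftInA {g} m = oR-R-intro (G ⊕ adj g) (rightMoveˡ G (adj g) m) (proj₁ (All.lookup pr m))
    mirrorRightInG : ∀ {g} → g ∈ r ∷ rs → oL (g ⊕ A) ≡ L
    mirrorRightInG {g} m = oL-L-intro (g ⊕ A) (leftMoveʳ g A (adjs-∈ m)) (proj₂ (All.lookup pr m))
    mirrorRightInA : ∀ {g} → g ∈ l ∷ ls → oL (G ⊕ adj g) ≡ L
    mirrorRightInA {g} m = oL-L-intro (G ⊕ adj g) (leftMoveˡ G (adj g) m) (proj₂ (All.lookup pl m))

mutual
  adjointP : ∀ {G} → IsDicot G → AdjointP G
  adjointP dicot-empty = refl , refl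
  adjointP (dicot-cons dls drs) = adjointP-step (adjointPs dls) (adjointPs drs)

  adjointPs : ∀ {gs} → All IsDicot gs → All AdjointP gs
  adjointPs [] = []
  adjointPs (d ∷ ds) = adjointP d ∷ adjointPs ds

LeftClause : Game → Game → Set
LeftClause G HL = Any (λ GL → GL ≥D HL) (leftOpts G) ⊎ Any (λ HLR → G ≥D HLR) (rightOpts HL)

RightClause : Game → Game → Set
RightClause H GR = Any (λ HR → GR ≥D HR) (rightOpts H) ⊎ Any (λ GRL → GRL ≥D H) (leftOpts GR)

Conditions : Game → Game → Set
Conditions G H = o G ≥ᵒ o H × All (LeftClause G) (leftOpts H) × All (RightClause H) (rightOpts G)

≥D-left : ∀ G H {X} → G ≥D H → IsDicot X → oL (H ⊕ X) ≡ L → oL (G ⊕ X) ≡ L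
≥D-left G H {X} G≥H dX = ≥ʳ-elim (proj₁ (≥ᵒ-components (G≥H X dX)))

≥D-right : ∀ G H {X} → G ≥D H → IsDicot X → oR (H ⊕ X) ≡ L → oR (G ⊕ X) ≡ L
≥D-right G H {X} G≥H dX = ≥ʳ-elim (proj₂ (≥ᵒ-components (G≥H X dX)))

module Sufficiency {G H : Game} (dG : IsDicot G) (dH : IsDicot H) (conditions : Conditions G H) where

  outcomes : o G ≥ᵒ o H
  outcomes = proj₁ conditions

  leftClauses : All (LeftClause G) (leftOpts H)
  leftClauses = proj₁ (proj₂ conditions)

  rightClauses : All (RightClause H) (rightOpts G)
  rightClauses = proj₂ (proj₂ conditions)

  Preserved : Game → Set
  Preserved X = (oL (H ⊕ X) ≡ L → oL (G ⊕ X) ≡ L) × (oR (H ⊕ X) ≡ L → oR (G ⊕ X) ≡ L)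

  -- Left's winning first move in H + X is in H (handled by condition (2))
  -- or in X (handled by induction); it is copied in G + X.  If H = X = 0,
  -- Left wins G moving first since o G ≥ o 0 = 𝓝.
  leftPreserved : ∀ X → IsDicot X → All Preserved (leftOpts X) → oL (H ⊕ X) ≡ L → oL (G ⊕ X) ≡ L
  leftPreserved X dX ih hWins with leftMove-or-zero dH dX
  ... | inj₁ (refl , refl) =
    subst (λ K → oL K ≡ L) (sym (⊕-zero G)) (≥ʳ-elim (proj₁ (≥ᵒ-components outcomes)) refl)
  ... | inj₂ (_ , m) with anyLeftMove⁻ H X (oL-L-elim (H ⊕ X) m hWins)
  ... | inj₁ viaH = let _ , mHL , e = find viaH in answerInH mHL e
    where
      answerInH : ∀ {HL} → HL ∈ leftOpts H → oR (HL ⊕ X) ≡ L → oL (G ⊕ X) ≡ L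
      answerInH {HL} mHL hlWins with All.lookup leftClauses mHL
      ... | inj₁ viaGL = let GL , mGL , GL≥HL = find viaGL in
        oL-L-intro (G ⊕ X) (leftMoveˡ G X mGL) (≥D-right GL HL GL≥HL dX hlWins)
      ... | inj₂ viaHLR = let HLR , mHLR , G≥HLR = find viaHLR in
        ≥D-left G HLR G≥HLR dX (All.lookup (oR-L-elim (HL ⊕ X) hlWins) (rightMoveˡ HL X mHLR))
  ... | inj₂ viaX = let _ , mXL , e = find viaX in
    oL-L-intro (G ⊕ X) (leftMoveʳ G X mXL) (proj₂ (All.lookup ih mXL) e)

  -- Every Right move in G + X is in G (handled by condition (3)) or in X
  -- (handled by induction), and Left wins after each of them.  The case
  -- G = X = 0 cannot occur: Right moving first wins 0 but loses H.
  rightPreserved : ∀ X → IsDicot X → All Preserved (rightOpts X) → oR (H ⊕ X) ≡ L → oR (G ⊕ X) ≡ L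
  rightPreserved X dX ih hWins with rightMove-or-zero dG dX
  ... | inj₁ (refl , refl) =
    ⊥-elim (R≢L (≥ʳ-elim (proj₂ (≥ᵒ-components outcomes)) (subst (λ K → oR K ≡ L) (⊕-zero H) hWins)))
  ... | inj₂ (_ , m) =
    oR-L-intro (G ⊕ X) m (allRightMoves G X (All.tabulate answerInG) (All.tabulate answerInX))
    where
      hAnswered : All (λ k → oL k ≡ L) (rightOpts (H ⊕ X))
      hAnswered = oR-L-elim (H ⊕ X) hWins

      answerInG : ∀ {GR} → GR ∈ rightOpts G → oL (GR ⊕ X) ≡ L
      answerInG {GR} mGR with All.lookup rightClauses mGR
      ... | inj₁ viaHR = let HR , mHR , GR≥HR = find viaHR in
        ≥D-left GR HR GR≥HR dX (All.lookup hAnswered (rightMoveˡ H X mHR))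
      ... | inj₂ viaGRL = let GRL , mGRL , GRL≥H = find viaGRL in
        oL-L-intro (GR ⊕ X) (leftMoveˡ GR X mGRL) (≥D-right GRL H GRL≥H dX hWins)

      answerInX : ∀ {XR} → XR ∈ rightOpts X → oL (G ⊕ XR) ≡ L
      answerInX mXR = proj₁ (All.lookup ih mXR) (All.lookup hAnswered (rightMoveʳ H X mXR))

  mutual
    preserved : ∀ {X} → IsDicot X → Preserved X
    preserved d@dicot-empty = leftPreserved _ d [] , rightPreserved _ d []
    preserved d@(dicot-cons dls drs) =
      leftPreserved _ d (preservedAll dls) , rightPreserved _ d (preservedAll drs)

    preservedAll : ∀ {xs} → All IsDicot xs → All Preserved xs
    preservedAll [] = []
    preservedAll (d ∷ ds) = preserved d ∷ preservedAll ds

  greater : G ≥D H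
  greater X dX = ≥ᵒ-from-components
    (≥ʳ-intro _ _ (proj₁ (preserved dX))) (≥ʳ-intro _ _ (proj₂ (preserved dX)))

sufficiency : ∀ {G H} → IsDicot G → IsDicot H → Conditions G H → G ≥D H
sufficiency = Sufficiency.greater

LeftGap : Game → Game → Game → Set
LeftGap G H X = oL (H ⊕ X) ≡ L × oL (G ⊕ X) ≡ R

RightGap : Game → Game → Game → Set
RightGap G H X = oR (H ⊕ X) ≡ L × oR (G ⊕ X) ≡ R

_⋡D_ : Game → Game → Set
G ⋡D H = Σ Game λ X → IsDicot X × (LeftGap G H X ⊎ RightGap G H X)

refutation-excludes : ∀ {G H} → G ⋡D H → ¬ (G ≥D H)
refutation-excludes {G} {H} (X , dX , inj₁ (hWins , gLoses)) G≥H =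
  R≢L (trans (sym gLoses) (≥D-left G H G≥H dX hWins))
refutation-excludes {G} {H} (X , dX , inj₂ (hWins , gLoses)) G≥H =
  R≢L (trans (sym gLoses) (≥D-right G H G≥H dX hWins))

gap-at-zero : ∀ G H → (oL H ≡ L × oL G ≡ R) ⊎ (oR H ≡ L × oR G ≡ R) →
  LeftGap G H zeroG ⊎ RightGap G H zeroG
gap-at-zero G H gap rewrite ⊕-zero G | ⊕-zero H = gap

outcome-or-refutation : ∀ G H → o G ≥ᵒ o H ⊎ G ⋡D H
outcome-or-refutation G H with ≥ʳ-or-gap (oL G) (oL H) | ≥ʳ-or-gap (oR G) (oR H)
... | inj₁ left | inj₁ right = inj₁ (≥ᵒ-from-components left right)
... | inj₂ gap | _ = inj₂ (zeroG , dicot-empty , gap-at-zero G H (inj₁ gap))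
... | inj₁ _ | inj₂ gap = inj₂ (zeroG , dicot-empty , gap-at-zero G H (inj₂ gap))

-- From a Left-first refutation Y of
-- G ≥D HR, the test t = {0, HR^R° | Y} refutes it with Right moving first:
-- in G + t Right wins by moving to G + Y, while in HR + t Left wins after
-- HR + Y by assumption and answers HR^R + t by moving to HR^R + HR^R°.
rightTest : ∀ {G HR} → IsDicot HR → G ⋡D HR → Σ Game λ t → IsDicot t × RightGap G HR t
rightTest dHR (Y , dY , inj₂ gap) = Y , dY , gap
rightTest {G} {HR} dHR (Y , dY , inj₁ (hrWins , gLoses)) =
  t , dicot-cons (dicot-empty ∷ adjs-dicot (dicotR dHR)) (dY ∷ []) ,
  oR-L-intro (HR ⊕ t) (rightMoveʳ HR t (here refl))
    (allRightMoves HR t (All.tabulate toAdjoint) (hrWins ∷ [])) ,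
  oR-R-intro (G ⊕ t) (rightMoveʳ G t (here refl)) gLoses
  where
    t : Game
    t = ⟨ zeroG ∷ adjs (rightOpts HR) ∣ [ Y ] ⟩
    toAdjoint : ∀ {HRR} → HRR ∈ rightOpts HR → oL (HRR ⊕ t) ≡ L
    toAdjoint {HRR} m = oL-L-intro (HRR ⊕ t) (leftMoveʳ HRR t (there (adjs-∈ m)))
      (proj₂ (adjointP (All.lookup (dicotR dHR) m)))

-- Dually, {Y | 0, GL^L°} turns a Right-first refutation Y of GL ≥D H into a
-- Left-first one.
leftTest : ∀ {GL H} → IsDicot GL → GL ⋡D H → Σ Game λ t → IsDicot t × LeftGap GL H t
leftTest dGL (Y , dY , inj₁ gap) = Y , dY , gap
leftTest {GL} {H} dGL (Y , dY , inj₂ (hWins , glLoses)) =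
  t , dicot-cons (dY ∷ []) (dicot-empty ∷ adjs-dicot (dicotL dGL)) ,
  oL-L-intro (H ⊕ t) (leftMoveʳ H t (here refl)) hWins ,
  oL-R-intro (GL ⊕ t) (leftMoveʳ GL t (here refl))
    (allLeftMoves GL t (All.tabulate toAdjoint) (glLoses ∷ []))
  where
    t : Game
    t = ⟨ [ Y ] ∣ zeroG ∷ adjs (leftOpts GL) ⟩
    toAdjoint : ∀ {GLL} → GLL ∈ leftOpts GL → oR (GLL ⊕ t) ≡ R
    toAdjoint {GLL} m = oR-R-intro (GLL ⊕ t) (rightMoveʳ GLL t (there (adjs-∈ m)))
      (proj₁ (adjointP (All.lookup (dicotL dGL) m)))

Downlinked : Game → Game → Set
Downlinked G H = Σ Game λ T → IsDicot T × oL (G ⊕ T) ≡ R × oR (H ⊕ T) ≡ L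

-- If every G^L fails to dominate H and G fails to dominate every H^R, then G
-- is downlinked to H, via T = {{0 | G°}, t_{H^R} | {H° | 0}, t_{G^L}} built
-- from one-sided refutations: each move in G + T or H + T has a winning reply
-- by the opponent into one of these tests or an adjoint.
downlinked : ∀ {G H} → IsDicot G → IsDicot H →
  All (λ GL → GL ⋡D H) (leftOpts G) → All (λ HR → G ⋡D HR) (rightOpts H) → Downlinked G H
downlinked {G} {H} dG dH refutedGL refutedHR = T , dT , gLoses , hWins
  where
    testHR : ∀ {HR} → HR ∈ rightOpts H → Σ Game λ t → IsDicot t × RightGap G HR t
    testHR m = rightTest {G} (All.lookup (dicotR dH) m) (All.lookup refutedHR m)

    testGL : ∀ {GL} → GL ∈ leftOpts G → Σ Game λ t → IsDicot t × LeftGap GL H t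
    testGL m = leftTest {H = H} (All.lookup (dicotL dG) m) (All.lookup refutedGL m)

    lefts rights : List Game
    lefts = mapWith∈ (rightOpts H) (λ m → proj₁ (testHR m))
    rights = mapWith∈ (leftOpts G) (λ m → proj₁ (testGL m))

    T : Game
    T = ⟨ ⟨ [ zeroG ] ∣ [ adj G ] ⟩ ∷ lefts ∣ ⟨ [ adj H ] ∣ [ zeroG ] ⟩ ∷ rights ⟩

    dT : IsDicot T
    dT = dicot-cons
      (dicot-cons (dicot-empty ∷ []) (adj-dicot dG ∷ []) ∷
       All-mapWith∈ _ (λ m → proj₁ (proj₂ (testHR m))))
      (dicot-cons (adj-dicot dH ∷ []) (dicot-empty ∷ []) ∷
       All-mapWith∈ _ (λ m → proj₁ (proj₂ (testGL m))))

    gLoses : oL (G ⊕ T) ≡ R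
    gLoses = oL-R-intro (G ⊕ T) (leftMoveʳ G T (here refl))
      (allLeftMoves G T (All.tabulate answerGL)
        (oR-R-intro (G ⊕ _) (rightMoveʳ G _ (here refl)) (proj₁ (adjointP dG)) ∷
         All-mapWith∈ _ (λ m → proj₂ (proj₂ (proj₂ (testHR m))))))
      where
        answerGL : ∀ {GL} → GL ∈ leftOpts G → oR (GL ⊕ T) ≡ R
        answerGL {GL} m = oR-R-intro (GL ⊕ T) (rightMoveʳ GL T (there (∈-mapWith∈ _ m)))
          (proj₂ (proj₂ (proj₂ (testGL m))))

    hWins : oR (H ⊕ T) ≡ L
    hWins = oR-L-intro (H ⊕ T) (rightMoveʳ H T (here refl))
      (allRightMoves H T (All.tabulate answerHR)
        (oL-L-intro (H ⊕ _) (leftMoveʳ H _ (here refl)) (proj₂ (adjointP dH)) ∷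
         All-mapWith∈ _ (λ m → proj₁ (proj₂ (proj₂ (testGL m))))))
      where
        answerHR : ∀ {HR} → HR ∈ rightOpts H → oL (HR ⊕ T) ≡ L
        answerHR {HR} m = oL-L-intro (HR ⊕ T) (leftMoveʳ HR T (there (∈-mapWith∈ _ m)))
          (proj₁ (proj₂ (proj₂ (testHR m))))

LeftFailure : Game → Game → Set
LeftFailure G HL = All (λ GL → GL ⋡D HL) (leftOpts G) × All (λ HLR → G ⋡D HLR) (rightOpts HL)

RightFailure : Game → Game → Set
RightFailure H GR = All (λ GRL → GRL ⋡D H) (leftOpts GR) × All (λ HR → GR ⋡D HR) (rightOpts H)

-- A failure of (2) at H^L: the test downlinking G to H^L lets Left win H + T
-- by moving to H^L + T, while Left loses G + T moving first.
leftFailure-refutes : ∀ {G H HL} → IsDicot G → IsDicot H → HL ∈ leftOpts H → LeftFailure G HL → G ⋡D H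
leftFailure-refutes {G} {H} dG dH m (refutedGL , refutedHLR)
  with downlinked dG (All.lookup (dicotL dH) m) refutedGL refutedHLR
... | T , dT , gLoses , hlWins = T , dT , inj₁ (oL-L-intro (H ⊕ T) (leftMoveˡ H T m) hlWins , gLoses)

-- A failure of (3) at G^R: the test downlinking G^R to H lets Right win G + T
-- by moving to G^R + T, while Left wins H + T when Right moves first.
rightFailure-refutes : ∀ {G H GR} → IsDicot G → IsDicot H → GR ∈ rightOpts G → RightFailure H GR → G ⋡D H
rightFailure-refutes {G} {H} dG dH m (refutedGRL , refutedHR)
  with downlinked (All.lookup (dicotR dG) m) dH refutedGRL refutedHR
... | T , dT , grLoses , hWins = T , dT , inj₂ (hWins , oR-R-intro (G ⊕ T) (rightMoveˡ G T m) grLoses)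

SmallerDecided : Game → Game → Set
SmallerDecided G H = ∀ {G′ H′} → size G′ + size H′ < size G + size H →
  IsDicot G′ → IsDicot H′ → G′ ≥D H′ ⊎ G′ ⋡D H′

leftClause-or-failure : ∀ {G H HL} → IsDicot G → IsDicot H → SmallerDecided G H →
  HL ∈ leftOpts H → LeftClause G HL ⊎ LeftFailure G HL
leftClause-or-failure {G} {H} {HL} dG dH decide mHL = some-or-none
  (λ mGL → decide (+-mono-< (sizeL G mGL) (sizeL H mHL)) (All.lookup (dicotL dG) mGL) dHL)
  (λ mHLR → decide (+-monoʳ-< (size G) (<-trans (sizeR HL mHLR) (sizeL H mHL))) dG
                   (All.lookup (dicotR dHL) mHLR))
  where
    dHL : IsDicot HL
    dHL = All.lookup (dicotL dH) mHL

rightClause-or-failure : ∀ {G H GR} → IsDicot G → IsDicot H → SmallerDecided G H →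
  GR ∈ rightOpts G → RightClause H GR ⊎ RightFailure H GR
rightClause-or-failure {G} {H} {GR} dG dH decide mGR = Sum.map₂ Product.swap (some-or-none
  (λ mHR → decide (+-mono-< (sizeR G mGR) (sizeR H mHR)) dGR (All.lookup (dicotR dH) mHR))
  (λ mGRL → decide (+-monoˡ-< (size H) (<-trans (sizeL GR mGRL) (sizeR G mGR)))
                   (All.lookup (dicotL dGR) mGRL) dH))
  where
    dGR : IsDicot GR
    dGR = All.lookup (dicotR dG) mGR

conditions-or-refutation-step : ∀ {G H} → IsDicot G → IsDicot H → SmallerDecided G H →
  Conditions G H ⊎ G ⋡D H
conditions-or-refutation-step {G} {H} dG dH decide
  with outcome-or-refutation G H
     | all-or-any (leftClause-or-failure dG dH decide)
     | all-or-any (rightClause-or-failure dG dH decide)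
... | inj₂ refuted | _ | _ = inj₂ refuted
... | inj₁ outcomes | inj₁ lefts | inj₁ rights = inj₁ (outcomes , lefts , rights)
... | inj₁ _ | inj₂ failure | _ =
  let _ , m , fails = find failure in inj₂ (leftFailure-refutes dG dH m fails)
... | inj₁ _ | inj₁ _ | inj₂ failure =
  let _ , m , fails = find failure in inj₂ (rightFailure-refutes dG dH m fails)

conditions-or-refutation : ∀ {G H} → IsDicot G → IsDicot H → Acc _<_ (size G + size H) →
  Conditions G H ⊎ G ⋡D H
conditions-or-refutation dG dH (acc smaller) = conditions-or-refutation-step dG dH
  (λ lt dG′ dH′ → Sum.map₁ (sufficiency dG′ dH′) (conditions-or-refutation dG′ dH′ (smaller lt)))

mainTheorem4 : ∀ G H → IsDicot G → IsDicot H →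
    G ≥D H ⇔
      (o G ≥ᵒ o H
      × All (λ HL → Any (λ GL → GL ≥D HL) (leftOpts G)
                    ⊎ Any (λ HLR → G ≥D HLR) (rightOpts HL)) (leftOpts H)
      × All (λ GR → Any (λ HR → GR ≥D HR) (rightOpts H)
                    ⊎ Any (λ GRL → GRL ≥D H) (leftOpts GR)) (rightOpts G))
mainTheorem4 G H dG dH = mk⇔ necessity (sufficiency dG dH)
  where
    necessity : G ≥D H → Conditions G H
    necessity G≥H with conditions-or-refutation dG dH (<-wellFounded (size G + size H))
    ... | inj₁ conditions = conditions
    ... | inj₂ refuted = ⊥-elim (refutation-excludes {G} {H} refuted G≥H)
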